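{- In the symplectic setting of the context: (1) $\langle C_{\mathrm{Schub}}\rangle$ is the set of $(a_1,\dots,a_n)\in\mathbf{Z}^n$ satisfying $(pa_{i+1}+a_{n-i})-(pa_i+a_{n+1-i})\le0$ for all $i=1,\dots,n-1$ and $pa_1+a_n\le0$; (2) $\langle C_{\mathrm{Schub}}\rangle$ is the smallest saturated submonoid of $\mathbf{Z}^n$ containing $\eta_\omega=-(p-1,\dots,p-1)$ and $S_1,\dots,S_{n-1}$, where $S_i=(1,\dots,1,0,\dots,0)-(0,\dots,0,p,\dots,p)$ with $1$ and $p$ each appearing $i$ times and $0$ appearing $n-i$ times.
   Context: $p$ a prime, $n\ge1$, $G=Sp(2n)$ over $\mathbf{F}_p$ with diagonal torus $T$, $X^*(T)=\mathbf{Z}^n$ (character $(a_i)$ sends $\mathrm{diag}(x_1,\dots,x_n,x_n^{ -1},\dots,x_1^{ -1})$ to $\prod x_i^{a_i}$), with dominant cone $X^*_+(T)=\{a_1\ge a_2\ge\dots\ge a_n\ge0\}$ (for the Borel of lower-triangular matrices). For the usual Hodge-type zip datum the map $h:X^*(T)\to X^*(T)$ (general formula $h(\lambda)=\lambda-(zw_0\lambda)\circ\varphi$) is $h(a_1,\dots,a_n)=(a_1,\dots,a_n)-p(a_n,\dots,a_1)$, and the Schubert cone is $C_{\mathrm{Schub}}=h(X^*_+(T))$. For a submonoid $C\subset\mathbf{Z}^n$, $\langle C\rangle=\{x:\exists m\ge1,\ mx\in C\}$; a submonoid is saturated if $\langle C\rangle=C$. -}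

module Defs where

open import Data.Nat as ℕ using (ℕ; zero; suc)
open import Data.Integer as ℤ using (ℤ; +_; -_; _-_; _*_; _+_; _≤_)
open import Data.Fin as Fin using (Fin; toℕ; inject₁; fromℕ; opposite)
open import Data.Vec as Vec using (Vec; lookup; tabulate; zipWith; replicate)
open import Data.Product using (Σ; ∃; _×_; _,_)
open import Relation.Binary.PropositionalEquality using (_≡_)
open import Relation.Nullary using (yes; no)

-- Vectors in Z^n (0-based indices; a_i of the paper is lookup a (i-1)).
Zn : ℕ → Set
Zn n = Vec ℤ n

_⊕_ : ∀ {n} → Zn n → Zn n → Zn n
_⊕_ = zipWith ℤ._+_

_·_ : ∀ {n} → ℕ → Zn n → Zn n
m · x = Vec.map (λ t → (+ m) ℤ.* t) x

𝟎 : ∀ {n} → Zn n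
𝟎 = replicate _ (+ 0)

Subset : ℕ → Set₁
Subset n = Zn n → Set

IsSubmonoid : ∀ {n} → Subset n → Set
IsSubmonoid C = C 𝟎 × (∀ x y → C x → C y → C (x ⊕ y))

Sat : ∀ {n} → Subset n → Subset n
Sat C x = Σ ℕ (λ m → (1 ℕ.≤ m) × C (m · x))

-- saturated: ⟨C⟩ = C  (C ⊆ ⟨C⟩ holds always with m = 1, so we only need ⟨C⟩ ⊆ C)
IsSaturated : ∀ {n} → Subset n → Set
IsSaturated C = ∀ x → Sat C x → C x

Dominant : ∀ {k} → Zn (suc k) → Set
Dominant {k} a = (∀ (j : Fin k) → lookup a (Fin.suc j) ≤ lookup a (inject₁ j))
               × (+ 0 ≤ lookup a (fromℕ k))

h : ∀ {n} → ℕ → Zn n → Zn n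
h p a = tabulate (λ j → lookup a j - (+ p) * lookup a (opposite j))

CSchub : ∀ k → ℕ → Subset (suc k)
CSchub k p x = ∃ λ (lam : Zn (suc k)) → Dominant lam × (x ≡ h p lam)

-- Explicit inequalities of part (1):
-- for i = 1..n-1 (0-based j = i-1 : Fin k, so a_i = a[inject₁ j], a_{i+1} = a[suc j],
-- a_{n+1-i} = a[opposite (inject₁ j)], a_{n-i} = a[opposite (suc j)]):
--   (p a_{i+1} + a_{n-i}) - (p a_i + a_{n+1-i}) ≤ 0,   and  p a_1 + a_n ≤ 0.
Ineqs : ∀ k → ℕ → Subset (suc k)
Ineqs k p a =
  (∀ (j : Fin k) →
     (((+ p) * lookup a (Fin.suc j) + lookup a (opposite (Fin.suc j)))
      - ((+ p) * lookup a (inject₁ j) + lookup a (opposite (inject₁ j)))) ≤ + 0)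
  × ((+ p) * lookup a Fin.zero + lookup a (fromℕ k) ≤ + 0)

η : ∀ n → ℕ → Zn n
η n p = replicate n (- ((+ p) - + 1))

-- S_i = (1,..,1,0,..,0) - (0,..,0,p,..,p), 1 and p each appearing i times (1-based i)
S : ∀ n → ℕ → ℕ → Zn n
S n p i = tabulate λ (j : Fin n) →
  (if< (toℕ j) i (+ 1) (+ 0)) - (if≤ (n ℕ.∸ i) (toℕ j) (+ p) (+ 0))
  where
  if< : ℕ → ℕ → ℤ → ℤ → ℤ
  if< a b u v with ℕ.suc a ℕ.≤? b
  ... | yes _ = u
  ... | no _ = v
  if≤ : ℕ → ℕ → ℤ → ℤ → ℤ
  if≤ a b u v with a ℕ.≤? b
  ... | yes _ = u
  ... | no _ = v

{-# OPTIONS --safe #-}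
-- With J the reversal of coordinates, h p = 1 - pJ has the adjugate h′ p = -(1 + pJ):
-- both composites are multiplication by p² - 1 ≥ 1. Hence m·a = h(x) with x dominant and
-- m ≥ 1 forces h′(a) to be dominant, and conversely (p² - 1)·a = h(h′(a)); so ⟨C_Schub⟩ is
-- the preimage of the dominant cone under h′, and unwinding dominance of h′(a) gives the
-- inequalities of (1). That preimage is visibly a saturated submonoid. For minimality,
-- a dominant x telescopes as x_n·(1,…,1) + Σ_t (x_t - x_{t+1})·ω_t with ω_t = (1,…,1,0,…,0)
-- (t ones), and h sends (1,…,1) to η_ω and ω_t to S_t.
module Submission where

open import Defs
open import Data.Nat using (ℕ; suc; _≤_; _<_)
open import Data.Nat.Primality using (Prime)
open import Data.Product using (_×_)
open import Function.Bundles using (_⇔_)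

open import Data.Nat as ℕ using (zero; z≤n; s≤s; _≤?_)
import Data.Nat.Properties as ℕₚ
open import Data.Nat.Primality using (prime⇒nonTrivial)
open import Data.Integer as ℤ using (ℤ; +_; -_; _+_; _-_; _*_; ∣_∣) renaming (_≤_ to _≤ᶻ_)
import Data.Integer.Properties as ℤₚ
open import Data.Integer.Tactic.RingSolver using (solve-∀)
open import Data.Fin as Fin using (Fin; toℕ; inject₁; fromℕ; opposite)
import Data.Fin.Properties as Finₚ
open import Data.Vec using ([]; _∷_; lookup; tabulate; replicate)
open import Data.Vec.Properties using (lookup-map; lookup-zipWith; lookup-replicate; lookup∘tabulate; tabulate-cong)
open import Data.Vec.Relation.Binary.Pointwise.Extensional using (ext; Pointwise-≡⇒≡)
open import Data.Product using (_,_; proj₁; proj₂)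
open import Function.Base using (_∘_)
open import Function.Bundles using (mk⇔; Equivalence)
open import Function.Construct.Composition using (_⇔-∘_)
open import Function.Construct.Symmetry using (⇔-sym)
open import Relation.Nullary using (Dec; yes; no; contradiction)
open import Relation.Binary.PropositionalEquality

private
  variable
    k n : ℕ

lookup-⊕ : (x y : Zn n) (j : Fin n) → lookup (x ⊕ y) j ≡ lookup x j + lookup y j
lookup-⊕ x y j = lookup-zipWith _+_ j x y

lookup-· : ∀ m (x : Zn n) (j : Fin n) → lookup (m · x) j ≡ + m * lookup x j
lookup-· m x j = lookup-map j _ x

lookup-𝟎 : (j : Fin n) → lookup (𝟎 {n}) j ≡ + 0
lookup-𝟎 j = lookup-replicate j _

·-identityˡ : (x : Zn n) → 1 · x ≡ x
·-identityˡ x = Pointwise-≡⇒≡ (ext λ j → trans (lookup-· 1 x j) (ℤₚ.*-identityˡ _))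

·-assoc : ∀ m m′ (x : Zn n) → (m ℕ.* m′) · x ≡ m · (m′ · x)
·-assoc m m′ x = Pointwise-≡⇒≡ (ext λ j → begin
  lookup ((m ℕ.* m′) · x) j    ≡⟨ lookup-· (m ℕ.* m′) x j ⟩
  + (m ℕ.* m′) * lookup x j    ≡⟨ cong (_* lookup x j) (ℤₚ.pos-* m m′) ⟩
  + m * + m′ * lookup x j      ≡⟨ ℤₚ.*-assoc (+ m) (+ m′) (lookup x j) ⟩
  + m * (+ m′ * lookup x j)    ≡⟨ cong (+ m *_) (lookup-· m′ x j) ⟨
  + m * lookup (m′ · x) j      ≡⟨ lookup-· m (m′ · x) j ⟨
  lookup (m · (m′ · x)) j      ∎)
  where open ≡-Reasoning

·-zeroˡ : (x : Zn n) → 0 · x ≡ 𝟎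
·-zeroˡ x = Pointwise-≡⇒≡ (ext λ j → trans (lookup-· 0 x j) (sym (lookup-𝟎 j)))

·-suc : ∀ c (x : Zn n) → suc c · x ≡ x ⊕ (c · x)
·-suc c x = Pointwise-≡⇒≡ (ext λ j → begin
  lookup (suc c · x) j                ≡⟨ lookup-· (suc c) x j ⟩
  + suc c * lookup x j                ≡⟨ 1+c-distrib (+ c) (lookup x j) ⟩
  lookup x j + + c * lookup x j       ≡⟨ cong (λ z → lookup x j + z) (lookup-· c x j) ⟨
  lookup x j + lookup (c · x) j       ≡⟨ lookup-⊕ x (c · x) j ⟨
  lookup (x ⊕ (c · x)) j              ∎)
  where
  open ≡-Reasoning
  1+c-distrib : ∀ c u → (+ 1 + c) * u ≡ u + c * u
  1+c-distrib = solve-∀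

⊆-Sat : {C : Subset n} (x : Zn n) → C x → Sat C x
⊆-Sat {C = C} x Cx = 1 , ℕₚ.≤-refl , subst C (sym (·-identityˡ x)) Cx

Sat-mono : {C D : Subset n} → (∀ x → C x → D x) → ∀ x → Sat C x → Sat D x
Sat-mono C⊆D x (m , 1≤m , Cmx) = m , 1≤m , C⊆D (m · x) Cmx

Sat-saturated : {C : Subset n} → IsSaturated (Sat C)
Sat-saturated {C = C} x (m , 1≤m , m′ , 1≤m′ , Cm′mx) =
  m′ ℕ.* m , ℕₚ.*-mono-≤ 1≤m′ 1≤m , subst C (sym (·-assoc m′ m x)) Cm′mx

IsSubmonoid-· : {C : Subset n} → IsSubmonoid C → ∀ c x → C x → C (c · x)
IsSubmonoid-· {C = C} (C𝟎 , _) zero x _ = subst C (sym (·-zeroˡ x)) C𝟎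
IsSubmonoid-· {C = C} C-submonoid@(_ , C-⊕) (suc c) x Cx =
  subst C (sym (·-suc c x)) (C-⊕ x (c · x) Cx (IsSubmonoid-· C-submonoid c x Cx))

IsSubmonoid-⇔ : {C D : Subset n} → (∀ x → C x ⇔ D x) → IsSubmonoid D → IsSubmonoid C
IsSubmonoid-⇔ C⇔D (D𝟎 , D-⊕) =
  Equivalence.from (C⇔D 𝟎) D𝟎 ,
  λ x y Cx Cy → Equivalence.from (C⇔D (x ⊕ y))
    (D-⊕ x y (Equivalence.to (C⇔D x) Cx) (Equivalence.to (C⇔D y) Cy))

IsAdditive : (Zn n → Zn n) → Set
IsAdditive f = f 𝟎 ≡ 𝟎 × (∀ x y → f (x ⊕ y) ≡ f x ⊕ f y)

IsSubmonoid-preimage : {C : Subset n} {f : Zn n → Zn n} →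
                       IsAdditive f → IsSubmonoid C → IsSubmonoid (λ x → C (f x))
IsSubmonoid-preimage {C = C} {f} (f𝟎 , f-⊕) (C𝟎 , C-⊕) =
  subst C (sym f𝟎) C𝟎 ,
  λ x y Cfx Cfy → subst C (sym (f-⊕ x y)) (C-⊕ (f x) (f y) Cfx Cfy)

Dominant-𝟎 : Dominant (𝟎 {suc k})
Dominant-𝟎 {k} =
  (λ j → ℤₚ.≤-reflexive (trans (lookup-𝟎 (Fin.suc j)) (sym (lookup-𝟎 (inject₁ j))))) ,
  ℤₚ.≤-reflexive (sym (lookup-𝟎 (fromℕ k)))

Dominant-⊕ : {x y : Zn (suc k)} → Dominant x → Dominant y → Dominant (x ⊕ y)
Dominant-⊕ {k} {x} {y} (x-dom , x₀) (y-dom , y₀) =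
  (λ j → subst₂ _≤ᶻ_ (sym (lookup-⊕ x y (Fin.suc j))) (sym (lookup-⊕ x y (inject₁ j)))
                     (ℤₚ.+-mono-≤ (x-dom j) (y-dom j))) ,
  subst (+ 0 ≤ᶻ_) (sym (lookup-⊕ x y (fromℕ k))) (ℤₚ.+-mono-≤ x₀ y₀)

Dominant-submonoid : IsSubmonoid (Dominant {k})
Dominant-submonoid = Dominant-𝟎 , λ x y → Dominant-⊕ {x = x} {y}

*-cancelˡ-≤-⇔ : ∀ m {u v} → 1 ≤ m → (+ m * u ≤ᶻ + m * v) ⇔ (u ≤ᶻ v)
*-cancelˡ-≤-⇔ (suc m) {u} {v} _ = mk⇔ (ℤₚ.*-cancelˡ-≤-pos u v (+ suc m)) (ℤₚ.*-monoˡ-≤-nonNeg (+ suc m))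

Dominant-·-⇔ : ∀ {m} (x : Zn (suc k)) → 1 ≤ m → Dominant (m · x) ⇔ Dominant x
Dominant-·-⇔ {k} {m} x 1≤m = mk⇔
  (λ (mx-dom , mx₀) → (λ j → Equivalence.to (step j) (mx-dom j)) , Equivalence.to last mx₀)
  (λ (x-dom , x₀) → (λ j → Equivalence.from (step j) (x-dom j)) , Equivalence.from last x₀)
  where
  step : ∀ j → (lookup (m · x) (Fin.suc j) ≤ᶻ lookup (m · x) (inject₁ j))
             ⇔ (lookup x (Fin.suc j) ≤ᶻ lookup x (inject₁ j))
  step j rewrite lookup-· m x (Fin.suc j) | lookup-· m x (inject₁ j) = *-cancelˡ-≤-⇔ m 1≤m
  last : (+ 0 ≤ᶻ lookup (m · x) (fromℕ k)) ⇔ (+ 0 ≤ᶻ lookup x (fromℕ k))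
  last rewrite lookup-· m x (fromℕ k) =
    subst (λ z → (z ≤ᶻ + m * lookup x (fromℕ k)) ⇔ _) (ℤₚ.*-zeroʳ (+ m)) (*-cancelˡ-≤-⇔ m 1≤m)

𝟏 : Zn n
𝟏 = replicate _ (+ 1)

Dominant-𝟏 : Dominant (𝟏 {suc k})
Dominant-𝟏 {k} =
  (λ j → ℤₚ.≤-reflexive (trans (lookup-replicate (Fin.suc j) (+ 1)) (sym (lookup-replicate (inject₁ j) (+ 1))))) ,
  subst (+ 0 ≤ᶻ_) (sym (lookup-replicate (fromℕ k) (+ 1))) (ℤ.+≤+ z≤n)

infix 3 _if_

_if_ : {P : Set} → ℤ → Dec P → ℤ
u if yes _ = u
u if no _  = + 0

if-mono : {P Q : Set} (P? : Dec P) (Q? : Dec Q) → (P → Q) → (+ 1 if P?) ≤ᶻ (+ 1 if Q?)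
if-mono (yes _) (yes _) _   = ℤₚ.≤-refl
if-mono (yes P) (no ¬Q) P→Q = contradiction (P→Q P) ¬Q
if-mono (no _)  (yes _) _   = ℤ.+≤+ z≤n
if-mono (no _)  (no _)  _   = ℤₚ.≤-refl

if-nonNeg : {P : Set} (P? : Dec P) → + 0 ≤ᶻ (+ 1 if P?)
if-nonNeg (yes _) = ℤ.+≤+ z≤n
if-nonNeg (no _)  = ℤₚ.≤-refl

fundamentalWeight : ∀ n → ℕ → Zn n
fundamentalWeight n i = tabulate (λ j → + 1 if suc (toℕ j) ≤? i)

lookup-fundamentalWeight : ∀ i (j : Fin n) → lookup (fundamentalWeight n i) j ≡ (+ 1 if suc (toℕ j) ≤? i)
lookup-fundamentalWeight i j = lookup∘tabulate _ j

Dominant-fundamentalWeight : ∀ i → Dominant (fundamentalWeight (suc k) i)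
Dominant-fundamentalWeight {k} i =
  (λ j → subst₂ _≤ᶻ_ (sym (lookup-fundamentalWeight i (Fin.suc j))) (sym (lookup-fundamentalWeight i (inject₁ j)))
           (if-mono (suc (suc (toℕ j)) ≤? i) (suc (toℕ (inject₁ j)) ≤? i)
                    (λ j+2≤i → subst (λ t → suc t ≤ i) (sym (Finₚ.toℕ-inject₁ j)) (ℕₚ.<⇒≤ j+2≤i)))) ,
  subst (+ 0 ≤ᶻ_) (sym (lookup-fundamentalWeight i (fromℕ k))) (if-nonNeg _)

at : Zn n → ℕ → ℤ
at []       _       = + 0
at (x ∷ _)  zero    = x
at (_ ∷ xs) (suc t) = at xs t

lookup≡at : (x : Zn n) (j : Fin n) → lookup x j ≡ at x (toℕ j)
lookup≡at (_ ∷ _)  Fin.zero    = refl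
lookup≡at (_ ∷ xs) (Fin.suc j) = lookup≡at xs j

Dominant⇒at-antitone : (x : Zn (suc k)) → Dominant x → ∀ t → t < k → at x (suc t) ≤ᶻ at x t
Dominant⇒at-antitone x (x-dom , _) t t<k =
  subst₂ _≤ᶻ_ (trans (lookup≡at x (Fin.suc j)) (cong (at x ∘ suc) (Finₚ.toℕ-fromℕ< t<k)))
              (trans (lookup≡at x (inject₁ j)) (cong (at x) (trans (Finₚ.toℕ-inject₁ j) (Finₚ.toℕ-fromℕ< t<k))))
              (x-dom j)
  where
  j = Fin.fromℕ< t<k

Dominant⇒0≤at-last : (x : Zn (suc k)) → Dominant x → + 0 ≤ᶻ at x k
Dominant⇒0≤at-last {k} x (_ , x₀) =
  subst (+ 0 ≤ᶻ_) (trans (lookup≡at x (fromℕ k)) (cong (at x) (Finₚ.toℕ-fromℕ k))) x₀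

flatten : Zn n → ℕ → Zn n
flatten x t = tabulate (λ j → at x (toℕ j ℕ.⊔ t))

lookup-flatten : (x : Zn n) (t : ℕ) (j : Fin n) → lookup (flatten x t) j ≡ at x (toℕ j ℕ.⊔ t)
lookup-flatten x t j = lookup∘tabulate _ j

flatten-zero : (x : Zn n) → flatten x 0 ≡ x
flatten-zero x = Pointwise-≡⇒≡ (ext λ j →
  trans (lookup-flatten x 0 j) (trans (cong (at x) (ℕₚ.⊔-identityʳ (toℕ j))) (sym (lookup≡at x j))))

flatten-last : (x : Zn (suc k)) → + 0 ≤ᶻ at x k → flatten x k ≡ ∣ at x k ∣ · 𝟏
flatten-last {k} x 0≤xₖ = Pointwise-≡⇒≡ (ext λ j → begin
  lookup (flatten x k) j                  ≡⟨ lookup-flatten x k j ⟩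
  at x (toℕ j ℕ.⊔ k)                      ≡⟨ cong (at x) (ℕₚ.m≤n⇒m⊔n≡n (Finₚ.toℕ≤pred[n] j)) ⟩
  at x k                                  ≡⟨ ℤₚ.0≤i⇒+∣i∣≡i 0≤xₖ ⟨
  + ∣ at x k ∣                            ≡⟨ ℤₚ.*-identityʳ _ ⟨
  + ∣ at x k ∣ * + 1                      ≡⟨ cong (+ ∣ at x k ∣ *_) (lookup-replicate j (+ 1)) ⟨
  + ∣ at x k ∣ * lookup 𝟏 j               ≡⟨ lookup-· ∣ at x k ∣ 𝟏 j ⟨
  lookup (∣ at x k ∣ · 𝟏) j               ∎)
  where open ≡-Reasoning

⊔-telescope : ∀ (f : ℕ → ℤ) i t → f (i ℕ.⊔ t) ≡ f (i ℕ.⊔ suc t) + (f t - f (suc t)) * (+ 1 if suc i ≤? suc t)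
⊔-telescope f i t with suc i ≤? suc t
... | yes i+1≤t+1 rewrite ℕₚ.m≤n⇒m⊔n≡n (ℕ.s≤s⁻¹ i+1≤t+1) | ℕₚ.m≤n⇒m⊔n≡n (ℕₚ.m≤n⇒m≤1+n (ℕ.s≤s⁻¹ i+1≤t+1)) =
  telescope (f t) (f (suc t))
  where
  telescope : ∀ u v → u ≡ v + (u - v) * + 1
  telescope = solve-∀
... | no i+1≰t+1 = beyond (ℕ.s≤s⁻¹ (ℕₚ.≰⇒> i+1≰t+1))
  where
  beyond : suc t ≤ i → f (i ℕ.⊔ t) ≡ f (i ℕ.⊔ suc t) + (f t - f (suc t)) * + 0
  beyond t+1≤i rewrite ℕₚ.m≥n⇒m⊔n≡m (ℕₚ.<⇒≤ t+1≤i) | ℕₚ.m≥n⇒m⊔n≡m t+1≤i = unchanged (f i) (f t - f (suc t))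
    where
    unchanged : ∀ u d → u ≡ u + d * + 0
    unchanged = solve-∀

flatten-step : (x : Zn n) (t : ℕ) → at x (suc t) ≤ᶻ at x t →
               flatten x t ≡ flatten x (suc t) ⊕ (∣ at x t - at x (suc t) ∣ · fundamentalWeight n (suc t))
flatten-step x t xₜ₊₁≤xₜ = Pointwise-≡⇒≡ (ext λ j → begin
  lookup (flatten x t) j
    ≡⟨ lookup-flatten x t j ⟩
  at x (toℕ j ℕ.⊔ t)
    ≡⟨ ⊔-telescope (at x) (toℕ j) t ⟩
  at x (toℕ j ℕ.⊔ suc t) + (at x t - at x (suc t)) * (+ 1 if suc (toℕ j) ≤? suc t)
    ≡⟨ cong₂ _+_ (lookup-flatten x (suc t) j)
                 (cong₂ _*_ (ℤₚ.0≤i⇒+∣i∣≡i (ℤₚ.i≤j⇒0≤j-i xₜ₊₁≤xₜ)) (lookup-fundamentalWeight (suc t) j)) ⟨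
  lookup (flatten x (suc t)) j + + c * lookup (fundamentalWeight _ (suc t)) j
    ≡⟨ cong (λ z → lookup (flatten x (suc t)) j + z) (lookup-· c (fundamentalWeight _ (suc t)) j) ⟨
  lookup (flatten x (suc t)) j + lookup (c · fundamentalWeight _ (suc t)) j
    ≡⟨ lookup-⊕ (flatten x (suc t)) _ j ⟨
  lookup (flatten x (suc t) ⊕ (c · fundamentalWeight _ (suc t))) j ∎)
  where
  open ≡-Reasoning
  c = ∣ at x t - at x (suc t) ∣

module _ {D : Subset (suc k)} (D-submonoid : IsSubmonoid D) (D𝟏 : D 𝟏)
         (Dω : ∀ i → 1 ≤ i → i < suc k → D (fundamentalWeight (suc k) i)) where

  Dominant⊆ : (x : Zn (suc k)) → Dominant x → D x
  Dominant⊆ x x-dom = subst D (flatten-zero x) (flatten∈D k 0 (ℕₚ.+-identityʳ k))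
    where
    flatten∈D : ∀ d t → d ℕ.+ t ≡ k → D (flatten x t)
    flatten∈D zero t refl =
      subst D (sym (flatten-last x (Dominant⇒0≤at-last x x-dom))) (IsSubmonoid-· D-submonoid ∣ at x k ∣ 𝟏 D𝟏)
    flatten∈D (suc d) t d+1+t≡k =
      subst D (sym (flatten-step x t (Dominant⇒at-antitone x x-dom t t<k)))
        (proj₂ D-submonoid _ _ (flatten∈D d (suc t) (trans (ℕₚ.+-suc d t) d+1+t≡k))
                               (IsSubmonoid-· D-submonoid ∣ at x t - at x (suc t) ∣ _ (Dω (suc t) (s≤s z≤n) (s≤s t<k))))
      where
      t<k : t < k
      t<k = subst (suc t ≤_) d+1+t≡k (s≤s (ℕₚ.m≤n+m t d))

L[_,_] : ℤ → ℤ → Zn n → Zn n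
L[ u , v ] x = tabulate (λ j → u * lookup x j + v * lookup x (opposite j))

lookup-L : ∀ u v (x : Zn n) (j : Fin n) → lookup (L[ u , v ] x) j ≡ u * lookup x j + v * lookup x (opposite j)
lookup-L u v x j = lookup∘tabulate _ j

L-additive : ∀ u v → IsAdditive (L[_,_] {n} u v)
L-additive u v = L-𝟎 , L-⊕
  where
  L-𝟎 : L[ u , v ] 𝟎 ≡ 𝟎
  L-𝟎 = Pointwise-≡⇒≡ (ext λ j → begin
    lookup (L[ u , v ] 𝟎) j                           ≡⟨ lookup-L u v 𝟎 j ⟩
    u * lookup 𝟎 j + v * lookup 𝟎 (opposite j)        ≡⟨ cong₂ (λ a b → u * a + v * b) (lookup-𝟎 j) (lookup-𝟎 (opposite j)) ⟩
    u * + 0 + v * + 0                                 ≡⟨ annihilate u v ⟩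
    + 0                                               ≡⟨ lookup-𝟎 j ⟨
    lookup 𝟎 j                                        ∎)
    where
    open ≡-Reasoning
    annihilate : ∀ u v → u * + 0 + v * + 0 ≡ + 0
    annihilate = solve-∀
  L-⊕ : ∀ x y → L[ u , v ] (x ⊕ y) ≡ L[ u , v ] x ⊕ L[ u , v ] y
  L-⊕ x y = Pointwise-≡⇒≡ (ext λ j → begin
    lookup (L[ u , v ] (x ⊕ y)) j
      ≡⟨ lookup-L u v (x ⊕ y) j ⟩
    u * lookup (x ⊕ y) j + v * lookup (x ⊕ y) (opposite j)
      ≡⟨ cong₂ (λ a b → u * a + v * b) (lookup-⊕ x y j) (lookup-⊕ x y (opposite j)) ⟩
    u * (lookup x j + lookup y j) + v * (lookup x (opposite j) + lookup y (opposite j))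
      ≡⟨ distribute u v _ _ _ _ ⟩
    (u * lookup x j + v * lookup x (opposite j)) + (u * lookup y j + v * lookup y (opposite j))
      ≡⟨ cong₂ _+_ (lookup-L u v x j) (lookup-L u v y j) ⟨
    lookup (L[ u , v ] x) j + lookup (L[ u , v ] y) j
      ≡⟨ lookup-⊕ (L[ u , v ] x) (L[ u , v ] y) j ⟨
    lookup (L[ u , v ] x ⊕ L[ u , v ] y) j
      ∎)
    where
    open ≡-Reasoning
    distribute : ∀ u v a b c d → u * (a + b) + v * (c + d) ≡ (u * a + v * c) + (u * b + v * d)
    distribute = solve-∀

L-· : ∀ u v m (x : Zn n) → L[ u , v ] (m · x) ≡ m · L[ u , v ] x
L-· u v m x = Pointwise-≡⇒≡ (ext λ j → begin
  lookup (L[ u , v ] (m · x)) j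
    ≡⟨ lookup-L u v (m · x) j ⟩
  u * lookup (m · x) j + v * lookup (m · x) (opposite j)
    ≡⟨ cong₂ (λ a b → u * a + v * b) (lookup-· m x j) (lookup-· m x (opposite j)) ⟩
  u * (+ m * lookup x j) + v * (+ m * lookup x (opposite j))
    ≡⟨ commute u v (+ m) _ _ ⟩
  + m * (u * lookup x j + v * lookup x (opposite j))
    ≡⟨ cong (+ m *_) (lookup-L u v x j) ⟨
  + m * lookup (L[ u , v ] x) j
    ≡⟨ lookup-· m (L[ u , v ] x) j ⟨
  lookup (m · L[ u , v ] x) j
    ∎)
  where
  open ≡-Reasoning
  commute : ∀ u v c a b → u * (c * a) + v * (c * b) ≡ c * (u * a + v * b)
  commute = solve-∀

L-∘ : ∀ u v u′ v′ (x : Zn n) → L[ u , v ] (L[ u′ , v′ ] x) ≡ L[ u * u′ + v * v′ , u * v′ + v * u′ ] x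
L-∘ u v u′ v′ x = Pointwise-≡⇒≡ (ext λ j → begin
  lookup (L[ u , v ] (L[ u′ , v′ ] x)) j
    ≡⟨ lookup-L u v (L[ u′ , v′ ] x) j ⟩
  u * lookup (L[ u′ , v′ ] x) j + v * lookup (L[ u′ , v′ ] x) (opposite j)
    ≡⟨ cong₂ (λ a b → u * a + v * b) (lookup-L u′ v′ x j) (lookup-L u′ v′ x (opposite j)) ⟩
  u * (u′ * lookup x j + v′ * lookup x (opposite j)) + v * (u′ * lookup x (opposite j) + v′ * lookup x (opposite (opposite j)))
    ≡⟨ cong (λ i → u * (u′ * lookup x j + v′ * lookup x (opposite j)) + v * (u′ * lookup x (opposite j) + v′ * lookup x i))
            (Finₚ.opposite-involutive j) ⟩
  u * (u′ * lookup x j + v′ * lookup x (opposite j)) + v * (u′ * lookup x (opposite j) + v′ * lookup x j)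
    ≡⟨ collect u v u′ v′ _ _ ⟩
  (u * u′ + v * v′) * lookup x j + (u * v′ + v * u′) * lookup x (opposite j)
    ≡⟨ lookup-L (u * u′ + v * v′) (u * v′ + v * u′) x j ⟨
  lookup (L[ u * u′ + v * v′ , u * v′ + v * u′ ] x) j
    ∎)
  where
  open ≡-Reasoning
  collect : ∀ u v u′ v′ a b → u * (u′ * a + v′ * b) + v * (u′ * b + v′ * a) ≡ (u * u′ + v * v′) * a + (u * v′ + v * u′) * b
  collect = solve-∀

L-scalar : ∀ m (x : Zn n) → L[ + m , + 0 ] x ≡ m · x
L-scalar m x = Pointwise-≡⇒≡ (ext λ j → begin
  lookup (L[ + m , + 0 ] x) j                     ≡⟨ lookup-L (+ m) (+ 0) x j ⟩
  + m * lookup x j + + 0 * lookup x (opposite j)  ≡⟨ ℤₚ.+-identityʳ _ ⟩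
  + m * lookup x j                                ≡⟨ lookup-· m x j ⟨
  lookup (m · x) j                                ∎)
  where open ≡-Reasoning

h≡L : ∀ p (x : Zn n) → h p x ≡ L[ + 1 , - + p ] x
h≡L p x = tabulate-cong λ j → as-combination (+ p) (lookup x j) (lookup x (opposite j))
  where
  as-combination : ∀ p a b → a - p * b ≡ + 1 * a + - p * b
  as-combination = solve-∀

h-additive : ∀ p → IsAdditive (h {n} p)
h-additive p =
  trans (h≡L p 𝟎) (proj₁ (L-additive (+ 1) (- + p))) ,
  λ x y → trans (h≡L p (x ⊕ y)) (trans (proj₂ (L-additive (+ 1) (- + p)) x y) (sym (cong₂ _⊕_ (h≡L p x) (h≡L p y))))

h′ : ℕ → Zn n → Zn n
h′ p = L[ - + 1 , - + p ]

+[p*p∸1] : ∀ p → 1 ≤ p → + (p ℕ.* p ℕ.∸ 1) ≡ + p * + p - + 1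
+[p*p∸1] p 1≤p = begin
  + (p ℕ.* p ℕ.∸ 1)       ≡⟨ ℤₚ.⊖-≥ (ℕₚ.*-mono-≤ 1≤p 1≤p) ⟨
  p ℕ.* p ℤ.⊖ 1            ≡⟨ ℤₚ.[+m]-[+n]≡m⊖n (p ℕ.* p) 1 ⟨
  + (p ℕ.* p) - + 1        ≡⟨ cong (_- + 1) (ℤₚ.pos-* p p) ⟩
  + p * + p - + 1          ∎
  where open ≡-Reasoning

h∘h′ : ∀ p → 1 ≤ p → (x : Zn n) → h p (h′ p x) ≡ (p ℕ.* p ℕ.∸ 1) · x
h∘h′ p 1≤p x = begin
  h p (h′ p x)                                                       ≡⟨ h≡L p (h′ p x) ⟩
  L[ + 1 , - + p ] (h′ p x)                                          ≡⟨ L-∘ (+ 1) (- + p) (- + 1) (- + p) x ⟩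
  L[ + 1 * - + 1 + - + p * - + p , + 1 * - + p + - + p * - + 1 ] x   ≡⟨ cong₂ (λ u v → L[ u , v ] x) (diagonal (+ p)) (antidiagonal (+ p)) ⟩
  L[ + p * + p - + 1 , + 0 ] x                                       ≡⟨ cong (λ u → L[ u , + 0 ] x) (+[p*p∸1] p 1≤p) ⟨
  L[ + (p ℕ.* p ℕ.∸ 1) , + 0 ] x                                     ≡⟨ L-scalar (p ℕ.* p ℕ.∸ 1) x ⟩
  (p ℕ.* p ℕ.∸ 1) · x                                                ∎
  where
  open ≡-Reasoning
  diagonal : ∀ p → + 1 * - + 1 + - p * - p ≡ p * p - + 1
  diagonal = solve-∀
  antidiagonal : ∀ p → + 1 * - p + - p * - + 1 ≡ + 0
  antidiagonal = solve-∀

h′∘h : ∀ p → 1 ≤ p → (x : Zn n) → h′ p (h p x) ≡ (p ℕ.* p ℕ.∸ 1) · x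
h′∘h p 1≤p x = begin
  h′ p (h p x)                                                       ≡⟨ cong (h′ p) (h≡L p x) ⟩
  L[ - + 1 , - + p ] (L[ + 1 , - + p ] x)                            ≡⟨ L-∘ (- + 1) (- + p) (+ 1) (- + p) x ⟩
  L[ - + 1 * + 1 + - + p * - + p , - + 1 * - + p + - + p * + 1 ] x   ≡⟨ cong₂ (λ u v → L[ u , v ] x) (diagonal (+ p)) (antidiagonal (+ p)) ⟩
  L[ + p * + p - + 1 , + 0 ] x                                       ≡⟨ cong (λ u → L[ u , + 0 ] x) (+[p*p∸1] p 1≤p) ⟨
  L[ + (p ℕ.* p ℕ.∸ 1) , + 0 ] x                                     ≡⟨ L-scalar (p ℕ.* p ℕ.∸ 1) x ⟩
  (p ℕ.* p ℕ.∸ 1) · x                                                ∎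
  where
  open ≡-Reasoning
  diagonal : ∀ p → - + 1 * + 1 + - p * - p ≡ p * p - + 1
  diagonal = solve-∀
  antidiagonal : ∀ p → - + 1 * - p + - p * + 1 ≡ + 0
  antidiagonal = solve-∀

lookup-h : ∀ p (x : Zn n) (j : Fin n) → lookup (h p x) j ≡ lookup x j - + p * lookup x (opposite j)
lookup-h p x j = lookup∘tabulate _ j

h-𝟏 : ∀ p → h p (𝟏 {n}) ≡ η n p
h-𝟏 {n} p = Pointwise-≡⇒≡ (ext λ j → begin
  lookup (h p 𝟏) j                        ≡⟨ lookup-h p 𝟏 j ⟩
  lookup 𝟏 j - + p * lookup 𝟏 (opposite j) ≡⟨ cong₂ (λ a b → a - + p * b) (lookup-replicate j (+ 1)) (lookup-replicate (opposite j) (+ 1)) ⟩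
  + 1 - + p * + 1                         ≡⟨ η-entry (+ p) ⟩
  - (+ p - + 1)                           ≡⟨ lookup-replicate j _ ⟨
  lookup (η n p) j                        ∎)
  where
  open ≡-Reasoning
  η-entry : ∀ p → + 1 - p * + 1 ≡ - (p - + 1)
  η-entry = solve-∀

*-if : ∀ u {P Q : Set} (P? : Dec P) (Q? : Dec Q) → (P → Q) → (Q → P) → u * (+ 1 if P?) ≡ (u if Q?)
*-if u (yes _) (yes _) _   _   = ℤₚ.*-identityʳ u
*-if u (yes P) (no ¬Q) P→Q _   = contradiction (P→Q P) ¬Q
*-if u (no ¬P) (yes Q) _   Q→P = contradiction (Q→P Q) ¬P
*-if u (no _)  (no _)  _   _   = ℤₚ.*-zeroʳ u

-- S is built from local `with`-functions of Defs that cannot be named here: `rhs` of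
-- `lookup∘tabulate` names the entry of S, and `with` on the two decisions then unfolds it.
rhs : {A : Set} {x y : A} → x ≡ y → A
rhs {y = y} _ = y

S-entry : ∀ n p i (j : Fin n) →
          rhs {x = lookup (S n p i) j} (lookup∘tabulate _ j) ≡ (+ 1 if suc (toℕ j) ≤? i) - (+ p if n ℕ.∸ i ≤? toℕ j)
S-entry n p i j with suc (toℕ j) ≤? i | n ℕ.∸ i ≤? toℕ j
... | yes _ | yes _ = refl
... | yes _ | no _  = refl
... | no _  | yes _ = refl
... | no _  | no _  = refl

lookup-S : ∀ n p i (j : Fin n) → lookup (S n p i) j ≡ (+ 1 if suc (toℕ j) ≤? i) - (+ p if n ℕ.∸ i ≤? toℕ j)
lookup-S n p i j = trans (lookup∘tabulate _ j) (S-entry n p i j)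

suc-toℕ-opposite : (j : Fin n) → suc (toℕ (opposite j)) ≡ n ℕ.∸ toℕ j
suc-toℕ-opposite {n} j = trans (cong suc (Finₚ.opposite-prop j)) (sym (ℕₚ.+-∸-assoc 1 (Finₚ.toℕ<n j)))

∸-≤-swap : ∀ m a b → m ℕ.∸ a ≤ b → m ℕ.∸ b ≤ a
∸-≤-swap m a b m∸a≤b = ℕₚ.m≤n+o⇒m∸n≤o m b (begin
  m               ≤⟨ ℕₚ.m≤n+m∸n m a ⟩
  a ℕ.+ (m ℕ.∸ a) ≤⟨ ℕₚ.+-monoʳ-≤ a m∸a≤b ⟩
  a ℕ.+ b         ≡⟨ ℕₚ.+-comm a b ⟩
  b ℕ.+ a         ∎)
  where open ℕₚ.≤-Reasoning

h-fundamentalWeight : ∀ p i → h p (fundamentalWeight n i) ≡ S n p i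
h-fundamentalWeight {n} p i = Pointwise-≡⇒≡ (ext λ j → begin
  lookup (h p ω) j
    ≡⟨ lookup-h p ω j ⟩
  lookup ω j - + p * lookup ω (opposite j)
    ≡⟨ cong₂ (λ a b → a - + p * b) (lookup-fundamentalWeight i j) (lookup-fundamentalWeight i (opposite j)) ⟩
  (+ 1 if suc (toℕ j) ≤? i) - + p * (+ 1 if suc (toℕ (opposite j)) ≤? i)
    ≡⟨ cong (λ b → (+ 1 if suc (toℕ j) ≤? i) - b)
            (*-if (+ p) (suc (toℕ (opposite j)) ≤? i) (n ℕ.∸ i ≤? toℕ j)
                  (λ le → ∸-≤-swap n (toℕ j) i (subst (_≤ i) (suc-toℕ-opposite j) le))
                  (λ le → subst (_≤ i) (sym (suc-toℕ-opposite j)) (∸-≤-swap n i (toℕ j) le))) ⟩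
  (+ 1 if suc (toℕ j) ≤? i) - (+ p if n ℕ.∸ i ≤? toℕ j)
    ≡⟨ lookup-S n p i j ⟨
  lookup (S n p i) j
    ∎)
  where
  open ≡-Reasoning
  ω = fundamentalWeight n i

opposite-inject₁ : (j : Fin k) → opposite (inject₁ j) ≡ Fin.suc (opposite j)
opposite-inject₁ j = trans (cong (opposite ∘ inject₁) (sym (Finₚ.opposite-involutive j)))
                           (Finₚ.opposite-involutive (Fin.suc (opposite j)))

neg-≤-⇔ : ∀ {a b} → (- a ≤ᶻ - b) ⇔ (b ≤ᶻ a)
neg-≤-⇔ = mk⇔ ℤₚ.neg-cancel-≤ ℤₚ.neg-mono-≤

≤-⇔-≤0 : ∀ {a b} → (a ≤ᶻ b) ⇔ (a - b ≤ᶻ + 0)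
≤-⇔-≤0 = mk⇔ ℤₚ.i≤j⇒i-j≤0 ℤₚ.i-j≤0⇒i≤j

Ineqs⇔Dominant-h′ : ∀ p (a : Zn (suc k)) → Ineqs k p a ⇔ Dominant (h′ p a)
Ineqs⇔Dominant-h′ {k} p a = mk⇔
  (λ (I , I₀) → (λ j → subst Step (Finₚ.opposite-involutive j) (Equivalence.from (step (opposite j)) (I (opposite j)))) ,
                Equivalence.from last I₀)
  (λ (d , d₀) → (λ j → Equivalence.to (step j) (d (opposite j))) , Equivalence.to last d₀)
  where
  B : Fin (suc k) → ℤ
  B j = + p * lookup a j + lookup a (opposite j)

  h′-opposite : ∀ j → lookup (h′ p a) (opposite j) ≡ - B j
  h′-opposite j = begin
    lookup (h′ p a) (opposite j)
      ≡⟨ lookup-L (- + 1) (- + p) a (opposite j) ⟩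
    - + 1 * lookup a (opposite j) + - + p * lookup a (opposite (opposite j))
      ≡⟨ cong (λ i → - + 1 * lookup a (opposite j) + - + p * lookup a i) (Finₚ.opposite-involutive j) ⟩
    - + 1 * lookup a (opposite j) + - + p * lookup a j
      ≡⟨ negate (+ p) (lookup a j) (lookup a (opposite j)) ⟩
    - B j
      ∎
    where
    open ≡-Reasoning
    negate : ∀ p a b → - + 1 * b + - p * a ≡ - (p * a + b)
    negate = solve-∀

  Step : Fin k → Set
  Step j = lookup (h′ p a) (Fin.suc j) ≤ᶻ lookup (h′ p a) (inject₁ j)

  step : ∀ j → Step (opposite j) ⇔ (B (Fin.suc j) - B (inject₁ j) ≤ᶻ + 0)
  step j = subst₂ (λ u v → (u ≤ᶻ v) ⇔ (B (Fin.suc j) - B (inject₁ j) ≤ᶻ + 0)) (sym at-suc) (sym at-inject₁) (≤-⇔-≤0 ⇔-∘ neg-≤-⇔)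
    where
    at-suc : lookup (h′ p a) (Fin.suc (opposite j)) ≡ - B (inject₁ j)
    at-suc = trans (cong (lookup (h′ p a)) (sym (opposite-inject₁ j))) (h′-opposite (inject₁ j))
    at-inject₁ : lookup (h′ p a) (inject₁ (opposite j)) ≡ - B (Fin.suc j)
    at-inject₁ = h′-opposite (Fin.suc j)

  last : (+ 0 ≤ᶻ lookup (h′ p a) (fromℕ k)) ⇔ (B Fin.zero ≤ᶻ + 0)
  last = subst (λ u → (+ 0 ≤ᶻ u) ⇔ (B Fin.zero ≤ᶻ + 0)) (sym (h′-opposite Fin.zero)) neg-≤-⇔

1≤p*p∸1 : ∀ {p} → 1 < p → 1 ≤ p ℕ.* p ℕ.∸ 1
1≤p*p∸1 1<p = ℕₚ.m+n≤o⇒m≤o∸n 1 (ℕₚ.*-mono-≤ 1<p (ℕₚ.<⇒≤ 1<p))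

Sat-CSchub⇔Dominant-h′ : ∀ {p} → 1 < p → (a : Zn (suc k)) → Sat (CSchub k p) a ⇔ Dominant (h′ p a)
Sat-CSchub⇔Dominant-h′ {k} {p} 1<p a = mk⇔ to from
  where
  1≤p = ℕₚ.<⇒≤ 1<p
  q = p ℕ.* p ℕ.∸ 1

  to : Sat (CSchub k p) a → Dominant (h′ p a)
  to (m , 1≤m , x , x-dom , ma≡hx) =
    Equivalence.to (Dominant-·-⇔ (h′ p a) 1≤m)
      (subst Dominant qx≡mh′a (Equivalence.from (Dominant-·-⇔ x (1≤p*p∸1 1<p)) x-dom))
    where
    open ≡-Reasoning
    qx≡mh′a : q · x ≡ m · h′ p a
    qx≡mh′a = begin
      q · x            ≡⟨ h′∘h p 1≤p x ⟨
      h′ p (h p x)     ≡⟨ cong (h′ p) ma≡hx ⟨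
      h′ p (m · a)     ≡⟨ L-· (- + 1) (- + p) m a ⟩
      m · h′ p a       ∎

  from : Dominant (h′ p a) → Sat (CSchub k p) a
  from h′a-dom = q , 1≤p*p∸1 1<p , h′ p a , h′a-dom , sym (h∘h′ p 1≤p a)

η∈CSchub : ∀ k p → CSchub k p (η (suc k) p)
η∈CSchub k p = 𝟏 , Dominant-𝟏 , sym (h-𝟏 p)

S∈CSchub : ∀ k p i → CSchub k p (S (suc k) p i)
S∈CSchub k p i = fundamentalWeight (suc k) i , Dominant-fundamentalWeight i , sym (h-fundamentalWeight p i)

CSchub⊆ : ∀ {p} {C : Subset (suc k)} → IsSubmonoid C → C (η (suc k) p) →
          (∀ i → 1 ≤ i → i < suc k → C (S (suc k) p i)) → ∀ x → CSchub k p x → C x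
CSchub⊆ {p = p} {C} C-submonoid Cη CS x (y , y-dom , x≡hy) =
  subst C (sym x≡hy)
    (Dominant⊆ (IsSubmonoid-preimage (h-additive p) C-submonoid)
               (subst C (sym (h-𝟏 p)) Cη)
               (λ i 1≤i i<n → subst C (sym (h-fundamentalWeight p i)) (CS i 1≤i i<n))
               y y-dom)

lemma4p2p1 : (p : ℕ) → Prime p → (k : ℕ) →
    -- (1) description of ⟨C_Schub⟩ by inequalities (n = suc k ≥ 1)
    (∀ (a : Zn (suc k)) → Sat (CSchub k p) a ⇔ Ineqs k p a)
    ×
    -- (2) ⟨C_Schub⟩ is the smallest saturated submonoid containing η_ω and S_1,...,S_{n-1}
    ((IsSubmonoid (Sat (CSchub k p))
      × IsSaturated (Sat (CSchub k p))
      × Sat (CSchub k p) (η (suc k) p)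
      × (∀ (i : ℕ) → 1 ≤ i → i < suc k → Sat (CSchub k p) (S (suc k) p i)))
     ×
     (∀ (C : Subset (suc k)) → IsSubmonoid C → IsSaturated C →
        C (η (suc k) p) →
        (∀ (i : ℕ) → 1 ≤ i → i < suc k → C (S (suc k) p i)) →
        ∀ a → Sat (CSchub k p) a → C a))
lemma4p2p1 p p-prime k =
    (λ a → ⇔-sym (Ineqs⇔Dominant-h′ p a) ⇔-∘ Sat-CSchub⇔Dominant-h′ 1<p a)
  , ( ( IsSubmonoid-⇔ (Sat-CSchub⇔Dominant-h′ 1<p)
                      (IsSubmonoid-preimage (L-additive (- + 1) (- + p)) Dominant-submonoid)
      , Sat-saturated {C = CSchub k p}
      , ⊆-Sat {C = CSchub k p} _ (η∈CSchub k p)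
      , λ i _ _ → ⊆-Sat {C = CSchub k p} _ (S∈CSchub k p i))
    , λ C C-submonoid C-saturated Cη CS a a∈ →
        C-saturated a (Sat-mono (CSchub⊆ C-submonoid Cη CS) a a∈))
  where
  1<p : 1 < p
  1<p = ℕ.nonTrivial⇒n>1 p ⦃ prime⇒nonTrivial p-prime ⦄
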